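{- For every graph $G$, $\gamma_{\rm gr}^t(G)\le 2\tau(G)$, where $\tau(G)$ is the vertex cover number of $G$.
   Context: All graphs are finite and simple. For a vertex $v$, $N(v)$ is its open neighborhood. A sequence $(v_1,\ldots,v_k)$ of distinct vertices is legal if for every $i\in\{1,\ldots,k\}$, $N(v_i)\setminus\bigcup_{j=1}^{i-1}N(v_j)\neq\emptyset$. $\gamma_{\rm gr}^t(G)$ is the maximum length of a legal sequence (for graphs without isolated vertices, the maximum length of a legal sequence whose vertex set totally dominates $G$). The vertex cover number $\tau(G)$ is the minimum size of a set of vertices meeting every edge. -}

module Defs where

open import Data.Nat using (ℕ; _≤_; _≥_)
open import Data.Fin using (Fin; _<_)
open import Data.Fin.Subset using (Subset; _∈_; ∣_∣)
open import Data.Product using (Σ; ∃; _×_)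
open import Data.Sum using (_⊎_)
open import Relation.Nullary using (¬_)
open import Function.Definitions using (Injective)
open import Relation.Binary.PropositionalEquality using (_≡_)

record Graph (n : ℕ) : Set₁ where
  field
    Adj     : Fin n → Fin n → Set
    sym     : ∀ {u v} → Adj u v → Adj v u
    irrefl  : ∀ {u} → ¬ Adj u u
open Graph public

-- u ∈ N(v)  iff  Adj v u.
-- A legal sequence (v_0,…,v_{k-1}) of distinct vertices: each v_i has a neighbour
-- not adjacent to any earlier v_j (j < i), i.e. N(v_i) ⊄ ⋃_{j<i} N(v_j).
record LegalSeq {n : ℕ} (G : Graph n) (k : ℕ) : Set where
  field
    seq      : Fin k → Fin n
    distinct : Injective _≡_ _≡_ seq
    legal    : ∀ i → ∃ λ u → Adj G (seq i) u × (∀ j → j < i → ¬ Adj G (seq j) u)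
open LegalSeq public

IsGrundyTotalDomNumber : ∀ {n} → Graph n → ℕ → Set
IsGrundyTotalDomNumber G g = LegalSeq G g × (∀ k → LegalSeq G k → k ≤ g)

IsVertexCover : ∀ {n} → Graph n → Subset n → Set
IsVertexCover G C = ∀ u v → Adj G u v → u ∈ C ⊎ v ∈ C

IsVertexCoverNumber : ∀ {n} → Graph n → ℕ → Set
IsVertexCoverNumber {n} G t =
  (Σ (Subset n) λ C → IsVertexCover G C × ∣ C ∣ ≡ t)
  × (∀ C → IsVertexCover G C → t ≤ ∣ C ∣)

-- Let (v₁,…,v_k) be legal and let uᵢ be a neighbour of vᵢ witnessing legality, i.e. not adjacent to
-- any earlier vⱼ. The uᵢ are pairwise distinct: if uᵢ = uⱼ with j < i, then uᵢ would be adjacent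
-- to vⱼ. Every edge vᵢuᵢ meets a vertex cover C, so sending i to vᵢ if vᵢ ∈ C and to uᵢ otherwise,
-- tagged by which of the two it is, injects {1,…,k} into two disjoint copies of C.
module Submission where

open import Defs hiding (sym)
open import Data.Nat using (ℕ; zero; suc; _≤_; _+_; _*_; z≤n; s≤s)
open import Data.Nat.Properties using (≤-trans; +-identityʳ)
open import Data.Fin as Fin using (Fin; _↑ˡ_; _↑ʳ_; join; splitAt)
open import Data.Fin.Properties using (suc-injective; <-cmp; splitAt-join)
open import Data.Fin.Subset using (Subset; _∈_; ∣_∣; _-_; inside; outside)
open import Data.Fin.Subset.Properties using (x∈p∧x≢y⇒x∈p-y; x∈p⇒∣p-x∣<∣p∣)
open import Data.Vec using ([]; _∷_; _++_)
open import Data.Vec.Properties using (lookup-++ˡ; lookup-++ʳ; []=⇒lookup; lookup⇒[]=)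
open import Data.Product using (_,_; proj₁; proj₂)
open import Data.Sum using (_⊎_; inj₁; inj₂)
open import Data.Sum.Properties using (inj₁-injective; inj₂-injective)
open import Data.Empty using (⊥-elim)
open import Relation.Nullary using (¬_)
open import Relation.Binary using (tri<; tri≈; tri>)
open import Relation.Binary.PropositionalEquality
  using (_≡_; _≢_; refl; sym; trans; cong; subst)
open import Function.Definitions using (Injective)

injective⇒≤∣p∣ : ∀ {k m} (p : Subset m) (f : Fin k → Fin m) →
                 Injective _≡_ _≡_ f → (∀ i → f i ∈ p) → k ≤ ∣ p ∣
injective⇒≤∣p∣ {zero}  p f f-inj f∈p = z≤n
injective⇒≤∣p∣ {suc k} p f f-inj f∈p =
  ≤-trans (s≤s (injective⇒≤∣p∣ (p - f Fin.zero) f∘suc f∘suc-inj f∘suc∈p-f₀))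
          (x∈p⇒∣p-x∣<∣p∣ (f∈p Fin.zero))
  where
  f∘suc : Fin k → Fin _
  f∘suc i = f (Fin.suc i)

  f∘suc-inj : Injective _≡_ _≡_ f∘suc
  f∘suc-inj eq = suc-injective (f-inj eq)

  suc≢zero : ∀ {i : Fin k} → Fin.suc i ≢ Fin.zero
  suc≢zero ()

  f∘suc∈p-f₀ : ∀ i → f∘suc i ∈ p - f Fin.zero
  f∘suc∈p-f₀ i = x∈p∧x≢y⇒x∈p-y (f∈p (Fin.suc i)) (λ eq → suc≢zero (f-inj eq))

∣p++q∣≡∣p∣+∣q∣ : ∀ {m n} (p : Subset m) (q : Subset n) → ∣ p ++ q ∣ ≡ ∣ p ∣ + ∣ q ∣
∣p++q∣≡∣p∣+∣q∣ []            q = refl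
∣p++q∣≡∣p∣+∣q∣ (inside  ∷ p) q = cong suc (∣p++q∣≡∣p∣+∣q∣ p q)
∣p++q∣≡∣p∣+∣q∣ (outside ∷ p) q = ∣p++q∣≡∣p∣+∣q∣ p q

x∈p⇒x↑ˡ∈p++q : ∀ {m n} {p : Subset m} (q : Subset n) {x} → x ∈ p → x ↑ˡ n ∈ p ++ q
x∈p⇒x↑ˡ∈p++q {p = p} q {x} x∈p = lookup⇒[]= _ (p ++ q) (trans (lookup-++ˡ p q x) ([]=⇒lookup x∈p))

x∈q⇒m↑ʳx∈p++q : ∀ {m n} (p : Subset m) {q : Subset n} {x} → x ∈ q → m ↑ʳ x ∈ p ++ q
x∈q⇒m↑ʳx∈p++q p {q} {x} x∈q = lookup⇒[]= _ (p ++ q) (trans (lookup-++ʳ p q x) ([]=⇒lookup x∈q))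

join-injective : ∀ m n → Injective _≡_ _≡_ (join m n)
join-injective m n {x} {y} eq =
  trans (sym (splitAt-join m n x)) (trans (cong (splitAt m) eq) (splitAt-join m n y))

module _ {n k} {G : Graph n} (L : LegalSeq G k) where

  footprint : Fin k → Fin n
  footprint i = proj₁ (legal L i)

  footprint-adjacent : ∀ i → Adj G (seq L i) (footprint i)
  footprint-adjacent i = proj₁ (proj₂ (legal L i))

  footprint-fresh : ∀ {i j} → j Fin.< i → ¬ Adj G (seq L j) (footprint i)
  footprint-fresh {i} {j} = proj₂ (proj₂ (legal L i)) j

  footprint-injective : Injective _≡_ _≡_ footprint
  footprint-injective {i} {j} eq with <-cmp i j
  ... | tri< i<j _ _ = ⊥-elim (footprint-fresh i<j (subst (Adj G (seq L i)) eq (footprint-adjacent i)))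
  ... | tri≈ _ i≡j _ = i≡j
  ... | tri> _ _ j<i = ⊥-elim (footprint-fresh j<i (subst (Adj G (seq L j)) (sym eq) (footprint-adjacent j)))

  module _ {C : Subset n} (cover : IsVertexCover G C) where

    edge-covered : ∀ i → seq L i ∈ C ⊎ footprint i ∈ C
    edge-covered i = cover (seq L i) (footprint i) (footprint-adjacent i)

    coveredEndpoint : ∀ {x y} → x ∈ C ⊎ y ∈ C → Fin n ⊎ Fin n
    coveredEndpoint {x} (inj₁ _) = inj₁ x
    coveredEndpoint {y = y} (inj₂ _) = inj₂ y

    join-coveredEndpoint∈C++C : ∀ {x y} (c : x ∈ C ⊎ y ∈ C) → join n n (coveredEndpoint c) ∈ C ++ C
    join-coveredEndpoint∈C++C (inj₁ x∈C) = x∈p⇒x↑ˡ∈p++q C x∈C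
    join-coveredEndpoint∈C++C (inj₂ y∈C) = x∈q⇒m↑ʳx∈p++q C y∈C

    coveredEndpoint-injective : ∀ {i j} (cᵢ : seq L i ∈ C ⊎ footprint i ∈ C)
      (cⱼ : seq L j ∈ C ⊎ footprint j ∈ C) → coveredEndpoint cᵢ ≡ coveredEndpoint cⱼ → i ≡ j
    coveredEndpoint-injective (inj₁ _) (inj₁ _) eq = distinct L (inj₁-injective eq)
    coveredEndpoint-injective (inj₂ _) (inj₂ _) eq = footprint-injective (inj₂-injective eq)
    coveredEndpoint-injective (inj₁ _) (inj₂ _) ()
    coveredEndpoint-injective (inj₂ _) (inj₁ _) ()

    legalSeq-length≤2∣cover∣ : k ≤ ∣ C ∣ + ∣ C ∣
    legalSeq-length≤2∣cover∣ = subst (k ≤_) (∣p++q∣≡∣p∣+∣q∣ C C)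
      (injective⇒≤∣p∣ (C ++ C) (λ i → join n n (coveredEndpoint (edge-covered i)))
        (λ {i} {j} eq → coveredEndpoint-injective (edge-covered i) (edge-covered j) (join-injective n n eq))
        (λ i → join-coveredEndpoint∈C++C (edge-covered i)))

proposition3p2 : (n : ℕ) (G : Graph n) (g t : ℕ)
    → IsGrundyTotalDomNumber G g → IsVertexCoverNumber G t → g ≤ 2 * t
proposition3p2 n G g t (L , _) ((C , cover , ∣C∣≡t) , _) =
  subst (g ≤_) twice∣C∣≡2t (legalSeq-length≤2∣cover∣ L cover)
  where
  twice∣C∣≡2t : ∣ C ∣ + ∣ C ∣ ≡ 2 * t
  twice∣C∣≡2t rewrite ∣C∣≡t | +-identityʳ t = refl
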